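{- If $k$ is an integer with $k \equiv 2 \pmod 4$ and $k \geq 10$, then $g_{\mathbb{Z}_2[\sqrt[3]{2}]}(k) = 8$.
   Context: For a ring $R$ and an integer $k > 1$, let $R^k$ denote the additive semigroup generated by all $k$-th powers of elements of $R$. The Waring number $g_R(k)$ is the smallest positive integer such that every element of $R^k$ can be written as a sum of at most $g_R(k)$ $k$-th powers of elements of $R$. $\mathbb{Z}_2$ denotes the $2$-adic integers and $\mathbb{Z}_2[\sqrt[3]{2}]$ is the ring of integers of $\mathbb{Q}_2(\sqrt[3]{2})$. -}

module Defs where

open import Data.Nat using (ℕ; zero; suc; _+_; _*_; _^_; _≤_; _<_)
open import Data.Nat.DivMod using (_%_)
open import Data.Product using (Σ; _×_; _,_; ∃)
open import Data.List using (List; []; _∷_; length)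
open import Relation.Binary.PropositionalEquality using (_≡_)
open import Relation.Nullary using (¬_)
open import Data.Nat.Properties using (m^n≢0)

_mod2^_ : ℕ → ℕ → ℕ
m mod2^ n = _%_ m (2 ^ n) {{m^n≢0 2 n}}

-- The 2-adic integers ℤ₂ = lim ℤ/2ⁿ, as compatible sequences of residues:
-- x n ∈ {0,…,2ⁿ-1} is the residue mod 2ⁿ, and x (n+1) ≡ x n (mod 2ⁿ).
-- (The compatibility condition forces x n < 2ⁿ.)

IsCompatible : (ℕ → ℕ) → Set
IsCompatible x = ∀ n → x (suc n) mod2^ n ≡ x n

ℤ₂ : Set
ℤ₂ = Σ (ℕ → ℕ) IsCompatible

residue : ℤ₂ → ℕ → ℕ
residue (x , _) = x

-- Raw elements of ℕ[π]/(π³ - 2): triples (a , b , c) meaning a + bπ + cπ².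

record T : Set where
  constructor tri
  field
    c₀ c₁ c₂ : ℕ
open T

_+T_ : T → T → T
tri a b c +T tri d e f = tri (a + d) (b + e) (c + f)

-- (a + bπ + cπ²)(d + eπ + fπ²) with π³ = 2
_*T_ : T → T → T
tri a b c *T tri d e f =
  tri (a * d + 2 * (b * f + c * e))
      (a * e + b * d + 2 * (c * f))
      (a * f + b * e + c * d)

oneT : T
oneT = tri 1 0 0

zeroT : T
zeroT = tri 0 0 0

powT : T → ℕ → T
powT t zero    = oneT
powT t (suc k) = t *T powT t k

_≡T_[mod2^_] : T → T → ℕ → Set
s ≡T t [mod2^ n ] =
  (c₀ s mod2^ n ≡ c₀ t mod2^ n) ×
  (c₁ s mod2^ n ≡ c₁ t mod2^ n) ×
  (c₂ s mod2^ n ≡ c₂ t mod2^ n)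

-- The ring R = ℤ₂[∛2] = ℤ₂[π]/(π³ - 2) (the ring of integers of ℚ₂(∛2)),
-- elements a + bπ + cπ² with a, b, c ∈ ℤ₂.  Its reduction mod 2ⁿ is
-- (ℤ/2ⁿ)[π]/(π³ - 2), and two expressions in R are equal iff they are
-- equal modulo 2ⁿ for every n.

record R : Set where
  constructor mkR
  field
    a b c : ℤ₂

level : R → ℕ → T
level (mkR a b c) n = tri (residue a n) (residue b n) (residue c n)

sumPowLevel : ℕ → List R → ℕ → T
sumPowLevel k []       n = zeroT
sumPowLevel k (y ∷ ys) n = powT (level y n) k +T sumPowLevel k ys n

IsSumOfPowers : ℕ → R → List R → Set
IsSumOfPowers k x ys = ∀ n → level x n ≡T sumPowLevel k ys n [mod2^ n ]

-- x ∈ R^k: the additive semigroup generated by the k-th powers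
-- (finite sums of k-th powers; the empty sum 0 = 0^k is in it anyway)
InPowerSemigroup : ℕ → R → Set
InPowerSemigroup k x = ∃ λ ys → IsSumOfPowers k x ys

WaringBound : ℕ → ℕ → Set
WaringBound k g =
  ∀ x → InPowerSemigroup k x → ∃ λ ys → length ys ≤ g × IsSumOfPowers k x ys

IsWaringNumber : ℕ → ℕ → Set
IsWaringNumber k g =
  1 ≤ g × WaringBound k g × (∀ m → 1 ≤ m → m < g → ¬ WaringBound k m)

{-# OPTIONS --safe #-}

-- Write k = 2m with m odd.  Modulo 8 a k-th power is 0 when its base is not a unit (t⁹ ≡ 0), and
-- otherwise the square of the unit t^m; conversely, the square r² of a unit r is the k-th power
-- (r^m)^k, since r¹⁶ ≡ 1 and m² ≡ 1 (mod 8).  So modulo 8 the k-th powers are 0 and the sixteen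
-- unit squares, whose sums have even π-coefficient.  A table of the least number of k-th powers
-- needed for each residue shows that every residue with even π-coefficient is a sum of at most
-- eight unit squares, and that 4π² needs eight.
--
-- Upper bound: if x ∈ R^k, write x ≡ Σ rⱼ² (mod 8) with at most eight unit roots rⱼ; then
-- x − Σ_{j>0} (rⱼ^m)^k ≡ (r₀^m)^k (mod 8) has a k-th root in R by Hensel lifting, because k = 2·odd
-- makes a correction of order 2^{n+2} fix an error of order 2^{n+3}.
-- Lower bound: the element Σ (rⱼ^m)^k built from the representation of 4π² lies in R^k, while a
-- sum of fewer than eight k-th powers never reduces to 4π² modulo 8.

module Submission where

open import Level using (0ℓ; _⊔_)
open import Algebra.Bundles using (CommutativeRing; Semiring)
open import Data.Nat.Base using (ℕ; zero; suc)

module ModularArithmetic {c ℓ} (R : CommutativeRing c ℓ) where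

  open CommutativeRing R
  open import Algebra.Definitions.RawSemiring (Semiring.rawSemiring semiring) using (_^_)
  open import Algebra.Definitions.RawMagma *-rawMagma using (_∣_; _,_)
  open import Algebra.Properties.Ring ring using (-‿distribʳ-*)
  open import Algebra.Properties.CommutativeSemigroup +-commutativeSemigroup using (interchange)
  open import Algebra.Properties.CommutativeSemigroup *-commutativeSemigroup using (x∙yz≈y∙xz; xy∙z≈y∙xz)
  open import Relation.Binary.Bundles using (Preorder)
  open import Relation.Binary.Structures using (IsPreorder)
  open import Relation.Binary.Reasoning.Setoid setoid
  import Relation.Binary.Reasoning.Preorder

  -- A record rather than a Σ-type, so that x, y and d are recovered by unification even when
  -- _+_ and _*_ compute.
  infix 4 _≡_[mod_]
  infixr 4 _,_
  record _≡_[mod_] (x y d : Carrier) : Set (c ⊔ ℓ) where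
    constructor _,_
    field
      quotient : Carrier
      equation : x ≈ y + d * quotient

  mod-multiple : ∀ x d w → x + d * w ≡ x [mod d ]
  mod-multiple x d w = w , refl

  mod-reflexive : ∀ {x y d} → x ≈ y → x ≡ y [mod d ]
  mod-reflexive {x} {y} {d} x≈y = 0# , (begin
    x            ≈⟨ x≈y ⟩
    y            ≈⟨ +-identityʳ y ⟨
    y + 0#       ≈⟨ +-congˡ (zeroʳ d) ⟨
    y + d * 0#   ∎)

  mod-refl : ∀ {x d} → x ≡ x [mod d ]
  mod-refl = mod-reflexive refl

  mod-sym : ∀ {x y d} → x ≡ y [mod d ] → y ≡ x [mod d ]
  mod-sym {x} {y} {d} (w , x≈y+dw) = - w , (begin
    y                         ≈⟨ +-identityʳ y ⟨
    y + 0#                    ≈⟨ +-congˡ (-‿inverseʳ (d * w)) ⟨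
    y + (d * w + - (d * w))   ≈⟨ +-assoc y (d * w) (- (d * w)) ⟨
    (y + d * w) + - (d * w)   ≈⟨ +-cong x≈y+dw (sym (-‿distribʳ-* d w)) ⟨
    x + d * - w               ∎)

  mod-trans : ∀ {x y z d} → x ≡ y [mod d ] → y ≡ z [mod d ] → x ≡ z [mod d ]
  mod-trans {x} {y} {z} {d} (u , x≈y+du) (v , y≈z+dv) = v + u , (begin
    x                     ≈⟨ x≈y+du ⟩
    y + d * u             ≈⟨ +-congʳ y≈z+dv ⟩
    (z + d * v) + d * u   ≈⟨ +-assoc z (d * v) (d * u) ⟩
    z + (d * v + d * u)   ≈⟨ +-congˡ (distribˡ d v u) ⟨
    z + d * (v + u)       ∎)

  ≡-mod-isPreorder : ∀ d → IsPreorder _≈_ (_≡_[mod d ])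
  ≡-mod-isPreorder d = record { isEquivalence = isEquivalence ; reflexive = mod-reflexive ; trans = mod-trans }

  ≡-mod-preorder : Carrier → Preorder c ℓ (c ⊔ ℓ)
  ≡-mod-preorder d = record { isPreorder = ≡-mod-isPreorder d }

  module ≡-mod-Reasoning (d : Carrier) = Relation.Binary.Reasoning.Preorder (≡-mod-preorder d)

  +-cong-mod : ∀ {x y x′ y′ d} → x ≡ y [mod d ] → x′ ≡ y′ [mod d ] → x + x′ ≡ y + y′ [mod d ]
  +-cong-mod {x} {y} {x′} {y′} {d} (u , x≈y+du) (v , x′≈y′+dv) = u + v , (begin
    x + x′                      ≈⟨ +-cong x≈y+du x′≈y′+dv ⟩
    (y + d * u) + (y′ + d * v)  ≈⟨ interchange y (d * u) y′ (d * v) ⟩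
    (y + y′) + (d * u + d * v)  ≈⟨ +-congˡ (distribˡ d u v) ⟨
    (y + y′) + d * (u + v)      ∎)

  *-cong-mod : ∀ {x y x′ y′ d} → x ≡ y [mod d ] → x′ ≡ y′ [mod d ] → x * x′ ≡ y * y′ [mod d ]
  *-cong-mod {x} {y} {x′} {y′} {d} (u , x≈y+du) (v , x′≈y′+dv) = y * v + u * x′ , (begin
    x * x′                                 ≈⟨ *-congʳ x≈y+du ⟩
    (y + d * u) * x′                       ≈⟨ distribʳ x′ y (d * u) ⟩
    y * x′ + (d * u) * x′                  ≈⟨ +-congʳ (*-congˡ x′≈y′+dv) ⟩
    y * (y′ + d * v) + (d * u) * x′        ≈⟨ +-congʳ (distribˡ y y′ (d * v)) ⟩
    (y * y′ + y * (d * v)) + (d * u) * x′  ≈⟨ +-assoc (y * y′) (y * (d * v)) ((d * u) * x′) ⟩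
    y * y′ + (y * (d * v) + (d * u) * x′)  ≈⟨ +-congˡ (+-cong (x∙yz≈y∙xz y d v) (*-assoc d u x′)) ⟩
    y * y′ + (d * (y * v) + d * (u * x′))  ≈⟨ +-congˡ (distribˡ d (y * v) (u * x′)) ⟨
    y * y′ + d * (y * v + u * x′)          ∎)

  ^-cong-mod : ∀ {x y d} → x ≡ y [mod d ] → ∀ n → x ^ n ≡ y ^ n [mod d ]
  ^-cong-mod x≡y zero    = mod-refl
  ^-cong-mod x≡y (suc n) = *-cong-mod x≡y (^-cong-mod x≡y n)

  ^-mod-1# : ∀ {x d} → x ≡ 1# [mod d ] → ∀ n → x ^ n ≡ 1# [mod d ]
  ^-mod-1# x≡1 zero    = mod-refl
  ^-mod-1# x≡1 (suc n) = mod-trans (*-cong-mod x≡1 (^-mod-1# x≡1 n)) (mod-reflexive (*-identityˡ 1#))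

  mod-∣ : ∀ {x y d e} → e ∣ d → x ≡ y [mod d ] → x ≡ y [mod e ]
  mod-∣ {x} {y} {d} {e} (q , qe≈d) (w , x≈y+dw) = q * w , (begin
    x                ≈⟨ x≈y+dw ⟩
    y + d * w        ≈⟨ +-congˡ (*-congʳ qe≈d) ⟨
    y + q * e * w    ≈⟨ +-congˡ (xy∙z≈y∙xz q e w) ⟩
    y + e * (q * w)  ∎)

  *-scale-mod : ∀ {x y d} c → x ≡ y [mod d ] → c * x ≡ c * y [mod c * d ]
  *-scale-mod {x} {y} {d} c (w , x≈y+dw) = w , (begin
    c * x                ≈⟨ *-congˡ x≈y+dw ⟩
    c * (y + d * w)      ≈⟨ distribˡ c y (d * w) ⟩
    c * y + c * (d * w)  ≈⟨ +-congˡ (*-assoc c d w) ⟨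
    c * y + (c * d) * w  ∎)

open import Defs
open import Algebra.Structures using (IsCommutativeRing)
open import Data.Nat.Base as ℕ using (_+_; _*_; _≤_; _<_; z≤n; s≤s; NonZero)
import Data.Nat.Properties as ℕ
open import Data.Nat.DivMod using (_%_; _/_; m≡m%n+[m/n]*n; [m+kn]%n≡m%n; m<n⇒m%n≡m; m%n<n; m%n%n≡m%n)
import Data.Nat.Tactic.RingSolver as ℕ-Solver
open import Data.Integer.Base as ℤ using (ℤ; +_; +0; -[1+_])
import Data.Integer.Properties as ℤ
open import Data.Integer.DivMod using (_%ℕ_; _/ℕ_; a≡a%ℕn+[a/ℕn]*n; n%ℕd<d)
open import Data.Integer.Tactic.RingSolver using (solve-∀)
open import Data.List.Base using (List; []; _∷_; foldr; map; length; find; upTo; cartesianProductWith; cartesianProduct)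
import Data.List.Properties as List
open import Data.List.Relation.Unary.All as All using (All; []; _∷_)
open import Data.List.Relation.Unary.Any using (here; there)
open import Data.List.Membership.Propositional using (_∈_)
open import Data.List.Membership.Propositional.Properties using (∈-cartesianProductWith⁺; ∈-cartesianProduct⁺; ∈-upTo⁺)
import Data.List.Membership.DecPropositional as DecMembership
open import Data.Maybe.Base using (just; nothing; maybe′)
open import Data.Product.Base using (Σ; ∃; _×_; _,_; proj₁; proj₂; uncurry)
open import Data.Sum.Base using (_⊎_; [_,_]′)
open import Function.Base using (_∘_)
open import Relation.Binary.Definitions using (DecidableEquality)
open import Relation.Binary.PropositionalEquality
open import Relation.Nullary.Decidable using (Dec; from-yes; map′; _×-dec_; _⊎-dec_; _→-dec_)
open import Relation.Nullary.Negation using (¬_)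
import Tactic.RingSolver as Solver
import Tactic.RingSolver.Core.AlmostCommutativeRing as ACR

-- The ring ℤ[π] = ℤ[X]/(X³ − 2), whose reductions modulo 2ⁿ are the levels of R

record ℤ[π] : Set where
  constructor ⟨_,_,_⟩
  field
    a₀ a₁ a₂ : ℤ

open ℤ[π]

infixl 6 _⊕_
infixl 7 _⊗_
infix 8 ⊖_

_⊕_ : ℤ[π] → ℤ[π] → ℤ[π]
⟨ a , b , c ⟩ ⊕ ⟨ d , e , f ⟩ = ⟨ a ℤ.+ d , b ℤ.+ e , c ℤ.+ f ⟩

⊖_ : ℤ[π] → ℤ[π]
⊖ ⟨ a , b , c ⟩ = ⟨ ℤ.- a , ℤ.- b , ℤ.- c ⟩

_⊗_ : ℤ[π] → ℤ[π] → ℤ[π]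
⟨ a , b , c ⟩ ⊗ ⟨ d , e , f ⟩ =
  ⟨ a ℤ.* d ℤ.+ + 2 ℤ.* (b ℤ.* f ℤ.+ c ℤ.* e)
  , a ℤ.* e ℤ.+ b ℤ.* d ℤ.+ + 2 ℤ.* (c ℤ.* f)
  , a ℤ.* f ℤ.+ b ℤ.* e ℤ.+ c ℤ.* d ⟩

𝟘 𝟙 : ℤ[π]
𝟘 = ⟨ + 0 , + 0 , + 0 ⟩
𝟙 = ⟨ + 1 , + 0 , + 0 ⟩

⟨⟩-cong : ∀ {a b c a′ b′ c′} → a ≡ a′ → b ≡ b′ → c ≡ c′ → ⟨ a , b , c ⟩ ≡ ⟨ a′ , b′ , c′ ⟩
⟨⟩-cong refl refl refl = refl

⊕-assoc : ∀ x y z → (x ⊕ y) ⊕ z ≡ x ⊕ (y ⊕ z)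
⊕-assoc ⟨ a , b , c ⟩ ⟨ d , e , f ⟩ ⟨ g , h , i ⟩ =
  ⟨⟩-cong (ℤ.+-assoc a d g) (ℤ.+-assoc b e h) (ℤ.+-assoc c f i)

⊕-comm : ∀ x y → x ⊕ y ≡ y ⊕ x
⊕-comm ⟨ a , b , c ⟩ ⟨ d , e , f ⟩ = ⟨⟩-cong (ℤ.+-comm a d) (ℤ.+-comm b e) (ℤ.+-comm c f)

⊕-identityˡ : ∀ x → 𝟘 ⊕ x ≡ x
⊕-identityˡ ⟨ a , b , c ⟩ = ⟨⟩-cong (ℤ.+-identityˡ a) (ℤ.+-identityˡ b) (ℤ.+-identityˡ c)

⊕-identityʳ : ∀ x → x ⊕ 𝟘 ≡ x
⊕-identityʳ x = trans (⊕-comm x 𝟘) (⊕-identityˡ x)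

⊖-inverseˡ : ∀ x → ⊖ x ⊕ x ≡ 𝟘
⊖-inverseˡ ⟨ a , b , c ⟩ = ⟨⟩-cong (ℤ.+-inverseˡ a) (ℤ.+-inverseˡ b) (ℤ.+-inverseˡ c)

⊖-inverseʳ : ∀ x → x ⊕ ⊖ x ≡ 𝟘
⊖-inverseʳ x = trans (⊕-comm x (⊖ x)) (⊖-inverseˡ x)

⊗-comm : ∀ x y → x ⊗ y ≡ y ⊗ x
⊗-comm ⟨ a , b , c ⟩ ⟨ d , e , f ⟩ = ⟨⟩-cong (comm₀ a b c d e f) (comm₁ a b c d e f) (comm₂ a b c d e f)
  where
  comm₀ : ∀ a b c d e f → a ℤ.* d ℤ.+ + 2 ℤ.* (b ℤ.* f ℤ.+ c ℤ.* e) ≡ d ℤ.* a ℤ.+ + 2 ℤ.* (e ℤ.* c ℤ.+ f ℤ.* b)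
  comm₀ = solve-∀
  comm₁ : ∀ a b c d e f → a ℤ.* e ℤ.+ b ℤ.* d ℤ.+ + 2 ℤ.* (c ℤ.* f) ≡ d ℤ.* b ℤ.+ e ℤ.* a ℤ.+ + 2 ℤ.* (f ℤ.* c)
  comm₁ = solve-∀
  comm₂ : ∀ a b c d e f → a ℤ.* f ℤ.+ b ℤ.* e ℤ.+ c ℤ.* d ≡ d ℤ.* c ℤ.+ e ℤ.* b ℤ.+ f ℤ.* a
  comm₂ = solve-∀

⊗-assoc : ∀ x y z → (x ⊗ y) ⊗ z ≡ x ⊗ (y ⊗ z)
⊗-assoc ⟨ a , b , c ⟩ ⟨ d , e , f ⟩ ⟨ g , h , i ⟩ =
  ⟨⟩-cong (assoc₀ a b c d e f g h i) (assoc₁ a b c d e f g h i) (assoc₂ a b c d e f g h i)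
  where
  assoc₀ : ∀ a b c d e f g h i →
    (a ℤ.* d ℤ.+ + 2 ℤ.* (b ℤ.* f ℤ.+ c ℤ.* e)) ℤ.* g
      ℤ.+ + 2 ℤ.* ((a ℤ.* e ℤ.+ b ℤ.* d ℤ.+ + 2 ℤ.* (c ℤ.* f)) ℤ.* i ℤ.+ (a ℤ.* f ℤ.+ b ℤ.* e ℤ.+ c ℤ.* d) ℤ.* h)
    ≡ a ℤ.* (d ℤ.* g ℤ.+ + 2 ℤ.* (e ℤ.* i ℤ.+ f ℤ.* h))
      ℤ.+ + 2 ℤ.* (b ℤ.* (d ℤ.* i ℤ.+ e ℤ.* h ℤ.+ f ℤ.* g) ℤ.+ c ℤ.* (d ℤ.* h ℤ.+ e ℤ.* g ℤ.+ + 2 ℤ.* (f ℤ.* i)))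
  assoc₀ = solve-∀
  assoc₁ : ∀ a b c d e f g h i →
    (a ℤ.* d ℤ.+ + 2 ℤ.* (b ℤ.* f ℤ.+ c ℤ.* e)) ℤ.* h ℤ.+ (a ℤ.* e ℤ.+ b ℤ.* d ℤ.+ + 2 ℤ.* (c ℤ.* f)) ℤ.* g
      ℤ.+ + 2 ℤ.* ((a ℤ.* f ℤ.+ b ℤ.* e ℤ.+ c ℤ.* d) ℤ.* i)
    ≡ a ℤ.* (d ℤ.* h ℤ.+ e ℤ.* g ℤ.+ + 2 ℤ.* (f ℤ.* i)) ℤ.+ b ℤ.* (d ℤ.* g ℤ.+ + 2 ℤ.* (e ℤ.* i ℤ.+ f ℤ.* h))
      ℤ.+ + 2 ℤ.* (c ℤ.* (d ℤ.* i ℤ.+ e ℤ.* h ℤ.+ f ℤ.* g))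
  assoc₁ = solve-∀
  assoc₂ : ∀ a b c d e f g h i →
    (a ℤ.* d ℤ.+ + 2 ℤ.* (b ℤ.* f ℤ.+ c ℤ.* e)) ℤ.* i ℤ.+ (a ℤ.* e ℤ.+ b ℤ.* d ℤ.+ + 2 ℤ.* (c ℤ.* f)) ℤ.* h
      ℤ.+ (a ℤ.* f ℤ.+ b ℤ.* e ℤ.+ c ℤ.* d) ℤ.* g
    ≡ a ℤ.* (d ℤ.* i ℤ.+ e ℤ.* h ℤ.+ f ℤ.* g) ℤ.+ b ℤ.* (d ℤ.* h ℤ.+ e ℤ.* g ℤ.+ + 2 ℤ.* (f ℤ.* i))
      ℤ.+ c ℤ.* (d ℤ.* g ℤ.+ + 2 ℤ.* (e ℤ.* i ℤ.+ f ℤ.* h))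
  assoc₂ = solve-∀

⊗-identityˡ : ∀ x → 𝟙 ⊗ x ≡ x
⊗-identityˡ ⟨ a , b , c ⟩ = ⟨⟩-cong (identity₀ a b c) (identity₁ a b c) (identity₂ a b c)
  where
  identity₀ : ∀ a b c → + 1 ℤ.* a ℤ.+ + 2 ℤ.* (+ 0 ℤ.* c ℤ.+ + 0 ℤ.* b) ≡ a
  identity₀ = solve-∀
  identity₁ : ∀ a b c → + 1 ℤ.* b ℤ.+ + 0 ℤ.* a ℤ.+ + 2 ℤ.* (+ 0 ℤ.* c) ≡ b
  identity₁ = solve-∀
  identity₂ : ∀ a b c → + 1 ℤ.* c ℤ.+ + 0 ℤ.* b ℤ.+ + 0 ℤ.* a ≡ c
  identity₂ = solve-∀

⊗-identityʳ : ∀ x → x ⊗ 𝟙 ≡ x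
⊗-identityʳ x = trans (⊗-comm x 𝟙) (⊗-identityˡ x)

⊗-distribˡ-⊕ : ∀ x y z → x ⊗ (y ⊕ z) ≡ x ⊗ y ⊕ x ⊗ z
⊗-distribˡ-⊕ ⟨ a , b , c ⟩ ⟨ d , e , f ⟩ ⟨ g , h , i ⟩ =
  ⟨⟩-cong (distrib₀ a b c d e f g h i) (distrib₁ a b c d e f g h i) (distrib₂ a b c d e f g h i)
  where
  distrib₀ : ∀ a b c d e f g h i →
    a ℤ.* (d ℤ.+ g) ℤ.+ + 2 ℤ.* (b ℤ.* (f ℤ.+ i) ℤ.+ c ℤ.* (e ℤ.+ h))
    ≡ (a ℤ.* d ℤ.+ + 2 ℤ.* (b ℤ.* f ℤ.+ c ℤ.* e)) ℤ.+ (a ℤ.* g ℤ.+ + 2 ℤ.* (b ℤ.* i ℤ.+ c ℤ.* h))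
  distrib₀ = solve-∀
  distrib₁ : ∀ a b c d e f g h i →
    a ℤ.* (e ℤ.+ h) ℤ.+ b ℤ.* (d ℤ.+ g) ℤ.+ + 2 ℤ.* (c ℤ.* (f ℤ.+ i))
    ≡ (a ℤ.* e ℤ.+ b ℤ.* d ℤ.+ + 2 ℤ.* (c ℤ.* f)) ℤ.+ (a ℤ.* h ℤ.+ b ℤ.* g ℤ.+ + 2 ℤ.* (c ℤ.* i))
  distrib₁ = solve-∀
  distrib₂ : ∀ a b c d e f g h i →
    a ℤ.* (f ℤ.+ i) ℤ.+ b ℤ.* (e ℤ.+ h) ℤ.+ c ℤ.* (d ℤ.+ g)
    ≡ (a ℤ.* f ℤ.+ b ℤ.* e ℤ.+ c ℤ.* d) ℤ.+ (a ℤ.* i ℤ.+ b ℤ.* h ℤ.+ c ℤ.* g)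
  distrib₂ = solve-∀

⊗-distribʳ-⊕ : ∀ x y z → (y ⊕ z) ⊗ x ≡ y ⊗ x ⊕ z ⊗ x
⊗-distribʳ-⊕ x y z = begin
  (y ⊕ z) ⊗ x     ≡⟨ ⊗-comm (y ⊕ z) x ⟩
  x ⊗ (y ⊕ z)     ≡⟨ ⊗-distribˡ-⊕ x y z ⟩
  x ⊗ y ⊕ x ⊗ z   ≡⟨ cong₂ _⊕_ (⊗-comm x y) (⊗-comm x z) ⟩
  y ⊗ x ⊕ z ⊗ x   ∎
  where open ≡-Reasoning

ℤ[π]-isCommutativeRing : IsCommutativeRing _≡_ _⊕_ _⊗_ ⊖_ 𝟘 𝟙
ℤ[π]-isCommutativeRing = record
  { isRing = record
    { +-isAbelianGroup = record
      { isGroup = record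
        { isMonoid = record
          { isSemigroup = record
            { isMagma = record { isEquivalence = isEquivalence ; ∙-cong = cong₂ _⊕_ }
            ; assoc = ⊕-assoc
            }
          ; identity = ⊕-identityˡ , ⊕-identityʳ
          }
        ; inverse = ⊖-inverseˡ , ⊖-inverseʳ
        ; ⁻¹-cong = cong ⊖_
        }
      ; comm = ⊕-comm
      }
    ; *-cong = cong₂ _⊗_
    ; *-assoc = ⊗-assoc
    ; *-identity = ⊗-identityˡ , ⊗-identityʳ
    ; distrib = ⊗-distribˡ-⊕ , ⊗-distribʳ-⊕
    }
  ; *-comm = ⊗-comm
  }

ℤ[π]-commutativeRing : CommutativeRing 0ℓ 0ℓ
ℤ[π]-commutativeRing = record { isCommutativeRing = ℤ[π]-isCommutativeRing }

-- Recognising the literal zero lets the ring solver cancel opposite terms.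
ℤ[π]-ring : ACR.AlmostCommutativeRing 0ℓ 0ℓ
ℤ[π]-ring = ACR.fromCommutativeRing ℤ[π]-commutativeRing isZero
  where
  isZero : ∀ x → _
  isZero ⟨ +0 , +0 , +0 ⟩ = just refl
  isZero _                = nothing

open import Algebra.Definitions.RawSemiring (Semiring.rawSemiring (CommutativeRing.semiring ℤ[π]-commutativeRing))
  using (_^_)
open import Algebra.Definitions.RawMagma (CommutativeRing.*-rawMagma ℤ[π]-commutativeRing) using (_∣_; _,_)
open import Algebra.Properties.CommutativeSemiring.Exp (CommutativeRing.commutativeSemiring ℤ[π]-commutativeRing)
  using (^-distrib-*; ^-homo-*; ^-assocʳ)
open ModularArithmetic ℤ[π]-commutativeRing
open ModularArithmetic ℤ.+-*-commutativeRing using ()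
  renaming (_≡_[mod_] to _≡_[modℤ_]; _,_ to _,ℤ_; mod-sym to modℤ-sym; mod-trans to modℤ-trans; mod-∣ to modℤ-∣)

κ : ℕ → ℤ[π]
κ n = ⟨ + n , + 0 , + 0 ⟩

κ-+ : ∀ m n → κ (m + n) ≡ κ m ⊕ κ n
κ-+ m n = ⟨⟩-cong (ℤ.pos-+ m n) refl refl

κ-⊗ : ∀ d a b c → κ d ⊗ ⟨ a , b , c ⟩ ≡ ⟨ + d ℤ.* a , + d ℤ.* b , + d ℤ.* c ⟩
κ-⊗ d a b c = ⟨⟩-cong (scale₀ (+ d) a b c) (scale₁ (+ d) a b c) (scale₂ (+ d) a b c)
  where
  scale₀ : ∀ d a b c → d ℤ.* a ℤ.+ + 2 ℤ.* (+ 0 ℤ.* c ℤ.+ + 0 ℤ.* b) ≡ d ℤ.* a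
  scale₀ = solve-∀
  scale₁ : ∀ d a b c → d ℤ.* b ℤ.+ + 0 ℤ.* a ℤ.+ + 2 ℤ.* (+ 0 ℤ.* c) ≡ d ℤ.* b
  scale₁ = solve-∀
  scale₂ : ∀ d a b c → d ℤ.* c ℤ.+ + 0 ℤ.* b ℤ.+ + 0 ℤ.* a ≡ d ℤ.* c
  scale₂ = solve-∀

κ-* : ∀ m n → κ (m * n) ≡ κ m ⊗ κ n
κ-* m n = trans (⟨⟩-cong (ℤ.pos-* m n) (sym (ℤ.*-zeroʳ (+ m))) (sym (ℤ.*-zeroʳ (+ m))))
  (sym (κ-⊗ m (+ n) (+ 0) (+ 0)))

𝟐^_ : ℕ → ℤ[π]
𝟐^ n = κ (2 ℕ.^ n)

𝟐^-* : ∀ m n → 𝟐^ m ⊗ 𝟐^ n ≡ 𝟐^ (m + n)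
𝟐^-* m n = trans (sym (κ-* (2 ℕ.^ m) (2 ℕ.^ n))) (cong κ (sym (ℕ.^-distribˡ-+-* 2 m n)))

𝟐^-∣ : ∀ {m n} → m ≤ n → 𝟐^ m ∣ 𝟐^ n
𝟐^-∣ {m} m≤n with ℕ.m≤n⇒∃[o]m+o≡n m≤n
... | o , refl = 𝟐^ o , trans (𝟐^-* o m) (cong 𝟐^_ (ℕ.+-comm o m))

mod-components : ∀ {x y} d → x ≡ y [mod κ d ] →
  (a₀ x ≡ a₀ y [modℤ + d ]) × (a₁ x ≡ a₁ y [modℤ + d ]) × (a₂ x ≡ a₂ y [modℤ + d ])
mod-components {y = y} d (⟨ a , b , c ⟩ , x≡y+dw) =
  (a ,ℤ cong a₀ x≡y+dw′) , (b ,ℤ cong a₁ x≡y+dw′) , (c ,ℤ cong a₂ x≡y+dw′)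
  where x≡y+dw′ = trans x≡y+dw (cong (y ⊕_) (κ-⊗ d a b c))

components-mod : ∀ {x y} d →
  a₀ x ≡ a₀ y [modℤ + d ] → a₁ x ≡ a₁ y [modℤ + d ] → a₂ x ≡ a₂ y [modℤ + d ] → x ≡ y [mod κ d ]
components-mod {y = y} d (a ,ℤ refl) (b ,ℤ refl) (c ,ℤ refl) = ⟨ a , b , c ⟩ , sym (cong (y ⊕_) (κ-⊗ d a b c))

-- Residues modulo 2ⁿ and 2-adic limits

embed : T → ℤ[π]
embed (tri a b c) = ⟨ + a , + b , + c ⟩

private
  pos-+′ : ∀ {m n i j} → + m ≡ i → + n ≡ j → + (m + n) ≡ i ℤ.+ j
  pos-+′ {m} {n} refl refl = ℤ.pos-+ m n

  pos-*′ : ∀ m {n j} → + n ≡ j → + (m * n) ≡ + m ℤ.* j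
  pos-*′ m {n} refl = ℤ.pos-* m n

embed-+ : ∀ s t → embed (s +T t) ≡ embed s ⊕ embed t
embed-+ (tri a b c) (tri d e f) = ⟨⟩-cong (ℤ.pos-+ a d) (ℤ.pos-+ b e) (ℤ.pos-+ c f)

embed-* : ∀ s t → embed (s *T t) ≡ embed s ⊗ embed t
embed-* (tri a b c) (tri d e f) = ⟨⟩-cong
  (pos-+′ (ℤ.pos-* a d) (pos-*′ 2 (pos-+′ (ℤ.pos-* b f) (ℤ.pos-* c e))))
  (pos-+′ (pos-+′ (ℤ.pos-* a e) (ℤ.pos-* b d)) (pos-*′ 2 (ℤ.pos-* c f)))
  (pos-+′ (pos-+′ (ℤ.pos-* a f) (ℤ.pos-* b e)) (ℤ.pos-* c d))

embed-powT : ∀ t k → embed (powT t k) ≡ embed t ^ k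
embed-powT t zero    = refl
embed-powT t (suc k) = trans (embed-* t (powT t k)) (cong (embed t ⊗_) (embed-powT t k))

pos≡pos%[modℤ] : ∀ a d .{{_ : NonZero d}} → + a ≡ + (a % d) [modℤ + d ]
pos≡pos%[modℤ] a d = + (a / d) ,ℤ trans
  (cong +_ (trans (m≡m%n+[m/n]*n a d) (cong (_+_ (a % d)) (ℕ.*-comm (a / d) d))))
  (pos-+′ refl (ℤ.pos-* d (a / d)))

%≡%-from-pos : ∀ {a b c} d .{{_ : NonZero d}} → + a ≡ + b ℤ.+ + d ℤ.* + c → a % d ≡ b % d
%≡%-from-pos {a} {b} {c} d eq = trans (cong (_% d) a≡b+cd) ([m+kn]%n≡m%n b c d)
  where
  a≡b+cd : a ≡ b + c * d
  a≡b+cd = ℤ.+-injective (trans eq (sym (pos-+′ refl (trans (ℤ.pos-* c d) (ℤ.*-comm (+ c) (+ d))))))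

mod2^⇒modℤ : ∀ {a b} n → a mod2^ n ≡ b mod2^ n → + a ≡ + b [modℤ + (2 ℕ.^ n) ]
mod2^⇒modℤ {a} {b} n a≡b = modℤ-trans (pos≡pos%[modℤ] a (2 ℕ.^ n) {{ℕ.m^n≢0 2 n}})
  (subst (λ r → + r ≡ + b [modℤ + (2 ℕ.^ n) ]) (sym a≡b) (modℤ-sym (pos≡pos%[modℤ] b (2 ℕ.^ n) {{ℕ.m^n≢0 2 n}})))

modℤ⇒mod2^ : ∀ {a b} n → + a ≡ + b [modℤ + (2 ℕ.^ n) ] → a mod2^ n ≡ b mod2^ n
modℤ⇒mod2^ n (+ c ,ℤ eq) = %≡%-from-pos (2 ℕ.^ n) {{ℕ.m^n≢0 2 n}} eq
modℤ⇒mod2^ n a≡b@(-[1+ c ] ,ℤ _) =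
  sym (%≡%-from-pos (2 ℕ.^ n) {{ℕ.m^n≢0 2 n}} (ModularArithmetic._≡_[mod_].equation (modℤ-sym a≡b)))

≡T⇒mod : ∀ {s t} n → s ≡T t [mod2^ n ] → embed s ≡ embed t [mod 𝟐^ n ]
≡T⇒mod {tri _ _ _} {tri _ _ _} n (a≡ , b≡ , c≡) =
  components-mod (2 ℕ.^ n) (mod2^⇒modℤ n a≡) (mod2^⇒modℤ n b≡) (mod2^⇒modℤ n c≡)

mod⇒≡T : ∀ {s t} n → embed s ≡ embed t [mod 𝟐^ n ] → s ≡T t [mod2^ n ]
mod⇒≡T n s≡t = modℤ⇒mod2^ n a≡ , modℤ⇒mod2^ n b≡ , modℤ⇒mod2^ n c≡
  where
  a≡ = proj₁ (mod-components (2 ℕ.^ n) s≡t)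
  b≡ = proj₁ (proj₂ (mod-components (2 ℕ.^ n) s≡t))
  c≡ = proj₂ (proj₂ (mod-components (2 ℕ.^ n) s≡t))

residue-< : ∀ (u : ℤ₂) n → residue u n < 2 ℕ.^ n
residue-< (u , u-compatible) n = subst (_< 2 ℕ.^ n) (u-compatible n) (m%n<n (u (suc n)) (2 ℕ.^ n) {{ℕ.m^n≢0 2 n}})

residue-mod2^ : ∀ (u : ℤ₂) n → residue u n mod2^ n ≡ residue u n
residue-mod2^ u n = m<n⇒m%n≡m {{ℕ.m^n≢0 2 n}} (residue-< u n)

Compatible : (ℕ → ℤ[π]) → Set
Compatible F = ∀ n → F (suc n) ≡ F n [mod 𝟐^ n ]

level-compatible : ∀ x → Compatible (embed ∘ level x)
level-compatible (mkR a b c) n = ≡T⇒mod n (step a , step b , step c)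
  where
  step : ∀ (u : ℤ₂) → residue u (suc n) mod2^ n ≡ residue u n mod2^ n
  step u = trans (proj₂ u n) (sym (residue-mod2^ u n))

compatible-mod : ∀ {F} → Compatible F → ∀ j n → F (j + n) ≡ F n [mod 𝟐^ n ]
compatible-mod F-compatible zero    n = mod-refl
compatible-mod F-compatible (suc j) n =
  mod-trans (mod-∣ (𝟐^-∣ (ℕ.m≤n+m n j)) (F-compatible (j + n))) (compatible-mod F-compatible j n)

module _ (f : ℕ → ℤ) (f-compatible : ∀ n → f (suc n) ≡ f n [modℤ + (2 ℕ.^ n) ]) where

  private
    r : ℕ → ℕ
    r n = _%ℕ_ (f n) (2 ℕ.^ n) {{ℕ.m^n≢0 2 n}}

  residue-limitℤ₂ : ∀ n → + r n ≡ f n [modℤ + (2 ℕ.^ n) ]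
  residue-limitℤ₂ n = modℤ-sym (q ,ℤ trans (a≡a%ℕn+[a/ℕn]*n (f n) (2 ℕ.^ n) {{ℕ.m^n≢0 2 n}})
    (cong (ℤ._+_ (+ r n)) (ℤ.*-comm q _)))
    where q = _/ℕ_ (f n) (2 ℕ.^ n) {{ℕ.m^n≢0 2 n}}

  limitℤ₂ : ℤ₂
  limitℤ₂ = r , r-compatible
    where
    halve : ∀ {a b} n → a ≡ b [modℤ + (2 ℕ.^ suc n) ] → a ≡ b [modℤ + (2 ℕ.^ n) ]
    halve n = modℤ-∣ record { quotient = + 2 ; equality = sym (ℤ.pos-* 2 (2 ℕ.^ n)) }

    r-compatible : IsCompatible r
    r-compatible n = trans
      (modℤ⇒mod2^ n (modℤ-trans (halve n (residue-limitℤ₂ (suc n)))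
                     (modℤ-trans (f-compatible n) (modℤ-sym (residue-limitℤ₂ n)))))
      (m<n⇒m%n≡m {{ℕ.m^n≢0 2 n}} (n%ℕd<d (f n) (2 ℕ.^ n) {{ℕ.m^n≢0 2 n}}))

limit : (F : ℕ → ℤ[π]) → Compatible F → R
limit F F-compatible = mkR
  (limitℤ₂ (a₀ ∘ F) (λ n → proj₁ (mod-components (2 ℕ.^ n) (F-compatible n))))
  (limitℤ₂ (a₁ ∘ F) (λ n → proj₁ (proj₂ (mod-components (2 ℕ.^ n) (F-compatible n)))))
  (limitℤ₂ (a₂ ∘ F) (λ n → proj₂ (proj₂ (mod-components (2 ℕ.^ n) (F-compatible n)))))

level-limit : ∀ F F-compatible n → embed (level (limit F F-compatible) n) ≡ F n [mod 𝟐^ n ]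
level-limit F F-compatible n = components-mod (2 ℕ.^ n)
  (residue-limitℤ₂ (a₀ ∘ F) (λ n → proj₁ (mod-components (2 ℕ.^ n) (F-compatible n))) n)
  (residue-limitℤ₂ (a₁ ∘ F) (λ n → proj₁ (proj₂ (mod-components (2 ℕ.^ n) (F-compatible n)))) n)
  (residue-limitℤ₂ (a₂ ∘ F) (λ n → proj₂ (proj₂ (mod-components (2 ℕ.^ n) (F-compatible n)))) n)

const : ℤ[π] → R
const x = limit (λ _ → x) (λ _ → mod-refl)

level-const : ∀ x n → embed (level (const x) n) ≡ x [mod 𝟐^ n ]
level-const x = level-limit (λ _ → x) (λ _ → mod-refl)

powerSum : ℕ → List ℤ[π] → ℤ[π]
powerSum k = foldr (λ x s → x ^ k ⊕ s) 𝟘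

levels : List R → ℕ → List ℤ[π]
levels ys n = map (λ y → embed (level y n)) ys

embed-sumPowLevel : ∀ k ys n → embed (sumPowLevel k ys n) ≡ powerSum k (levels ys n)
embed-sumPowLevel k []       n = refl
embed-sumPowLevel k (y ∷ ys) n = trans (embed-+ (powT (level y n) k) (sumPowLevel k ys n))
  (cong₂ _⊕_ (embed-powT (level y n) k) (embed-sumPowLevel k ys n))

mod⇒isSumOfPowers : ∀ k x ys → (∀ n → embed (level x n) ≡ powerSum k (levels ys n) [mod 𝟐^ n ]) →
  IsSumOfPowers k x ys
mod⇒isSumOfPowers k x ys x≡Σ n =
  mod⇒≡T n (subst (embed (level x n) ≡_[mod 𝟐^ n ]) (sym (embed-sumPowLevel k ys n)) (x≡Σ n))

powerSum-cong-mod : ∀ {A : Set} {f g : A → ℤ[π]} {d} k → (∀ a → f a ≡ g a [mod d ]) →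
  ∀ as → powerSum k (map f as) ≡ powerSum k (map g as) [mod d ]
powerSum-cong-mod k f≡g []       = mod-refl
powerSum-cong-mod k f≡g (a ∷ as) = +-cong-mod (^-cong-mod (f≡g a) k) (powerSum-cong-mod k f≡g as)

powerSum-levels-const : ∀ {A : Set} k (f : A → ℤ[π]) as n →
  powerSum k (map f as) ≡ powerSum k (levels (map (const ∘ f) as) n) [mod 𝟐^ n ]
powerSum-levels-const k f as n = subst (powerSum k (map f as) ≡_[mod 𝟐^ n ]) (cong (powerSum k) (List.map-∘ as))
  (powerSum-cong-mod k (λ a → mod-sym (level-const (f a) n)) as)

-- Hensel lifting for exponents k = 2 + 4i

k≡2m : ∀ i → 2 + 4 * i ≡ 2 * (1 + 2 * i)
k≡2m = ℕ-Solver.solve-∀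

binomial-mod : ∀ x h n → (x ⊕ h) ^ suc n ≡ x ^ suc n ⊕ κ (suc n) ⊗ h ⊗ x ^ n [mod h ⊗ h ]
binomial-mod x h zero    = mod-reflexive (expand₀ x h)
  where
  expand₀ : ∀ x h → (x ⊕ h) ⊗ 𝟙 ≡ x ⊗ 𝟙 ⊕ 𝟙 ⊗ h ⊗ 𝟙
  expand₀ = Solver.solve-∀ ℤ[π]-ring
binomial-mod x h (suc n) = mod-trans (*-cong-mod (mod-refl {x ⊕ h}) (binomial-mod x h n))
  (κ (suc n) ⊗ x ^ n , expand x h (κ (suc n)) (x ^ n))
  where
  expand : ∀ x h c y →
    (x ⊕ h) ⊗ (x ⊗ y ⊕ c ⊗ h ⊗ y) ≡ x ⊗ (x ⊗ y) ⊕ (𝟙 ⊕ c) ⊗ h ⊗ (x ⊗ y) ⊕ h ⊗ h ⊗ (c ⊗ y)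
  expand = Solver.solve-∀ ℤ[π]-ring

module _ (i : ℕ) where

  private
    k₁ k m : ℕ
    k₁ = 1 + 4 * i
    k  = 2 + 4 * i
    m  = 1 + 2 * i

  newton-expansion : ∀ n z r G →
    (z ⊕ 𝟐^ (2 + n) ⊗ (r ⊗ G)) ^ k ≡ z ^ k ⊕ 𝟐^ (3 + n) ⊗ (r ⊗ (κ m ⊗ (G ⊗ z ^ k₁))) [mod 𝟐^ (4 + n) ]
  newton-expansion n z r G =
    mod-trans (mod-∣ E∣h² (binomial-mod z h k₁)) (mod-reflexive (cong (z ^ k ⊕_) linear-term))
    where
    open ≡-Reasoning
    P = 𝟐^ (2 + n)
    u = r ⊗ G
    h = P ⊗ u

    E∣h² : 𝟐^ (4 + n) ∣ h ⊗ h
    E∣h² = 𝟐^ n ⊗ (u ⊗ u) , (begin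
      𝟐^ n ⊗ (u ⊗ u) ⊗ 𝟐^ (4 + n)     ≡⟨ regroup (𝟐^ n) (𝟐^ (4 + n)) u ⟩
      𝟐^ n ⊗ 𝟐^ (4 + n) ⊗ (u ⊗ u)     ≡⟨ cong (_⊗ (u ⊗ u)) 2ⁿ2ⁿ⁺⁴≡P² ⟩
      P ⊗ P ⊗ (u ⊗ u)                 ≡⟨ regroup′ P u ⟩
      h ⊗ h                           ∎)
      where
      regroup : ∀ a e u → a ⊗ (u ⊗ u) ⊗ e ≡ a ⊗ e ⊗ (u ⊗ u)
      regroup = Solver.solve-∀ ℤ[π]-ring
      regroup′ : ∀ p u → p ⊗ p ⊗ (u ⊗ u) ≡ p ⊗ u ⊗ (p ⊗ u)
      regroup′ = Solver.solve-∀ ℤ[π]-ring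
      exponents : ∀ n → n + (4 + n) ≡ (2 + n) + (2 + n)
      exponents = ℕ-Solver.solve-∀
      2ⁿ2ⁿ⁺⁴≡P² : 𝟐^ n ⊗ 𝟐^ (4 + n) ≡ P ⊗ P
      2ⁿ2ⁿ⁺⁴≡P² = trans (𝟐^-* n (4 + n)) (trans (cong 𝟐^_ (exponents n)) (sym (𝟐^-* (2 + n) (2 + n))))

    linear-term : κ k ⊗ h ⊗ z ^ k₁ ≡ 𝟐^ (3 + n) ⊗ (r ⊗ (κ m ⊗ (G ⊗ z ^ k₁)))
    linear-term = begin
      κ k ⊗ h ⊗ z ^ k₁                        ≡⟨ cong (λ c → c ⊗ h ⊗ z ^ k₁) (trans (cong κ (k≡2m i)) (κ-* 2 m)) ⟩
      κ 2 ⊗ κ m ⊗ h ⊗ z ^ k₁                  ≡⟨ regroup (κ 2) (κ m) P r G (z ^ k₁) ⟩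
      κ 2 ⊗ P ⊗ (r ⊗ (κ m ⊗ (G ⊗ z ^ k₁)))    ≡⟨ cong (_⊗ (r ⊗ (κ m ⊗ (G ⊗ z ^ k₁)))) (𝟐^-* 1 (2 + n)) ⟩
      𝟐^ (3 + n) ⊗ (r ⊗ (κ m ⊗ (G ⊗ z ^ k₁))) ∎
      where
      regroup : ∀ c m p r g y → c ⊗ m ⊗ (p ⊗ (r ⊗ g)) ⊗ y ≡ c ⊗ p ⊗ (r ⊗ (m ⊗ (g ⊗ y)))
      regroup = Solver.solve-∀ ℤ[π]-ring

  -- Newton's step: as k = 2m with m odd and G inverts z^{k-1} modulo 2, the correction
  -- 2^{n+2}·r·G changes z^k by 2^{n+3}·r modulo 2^{n+4}.
  hensel-step : ∀ {z t G} n → G ⊗ z ^ k₁ ≡ 𝟙 [mod κ 2 ] → t ≡ z ^ k [mod 𝟐^ (3 + n) ] →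
    Σ ℤ[π] λ z′ → z′ ≡ z [mod 𝟐^ (2 + n) ] × t ≡ z′ ^ k [mod 𝟐^ (4 + n) ]
  hensel-step {z} {t} {G} n Gz≡1 (r , t≡z^k+Dr) =
    z ⊕ 𝟐^ (2 + n) ⊗ (r ⊗ G) , mod-multiple z (𝟐^ (2 + n)) (r ⊗ G) , mod-sym z′^k≡t
    where
    D = 𝟐^ (3 + n)
    X = κ m ⊗ (G ⊗ z ^ k₁)

    X≡1 : X ≡ 𝟙 [mod κ 2 ]
    X≡1 = mod-trans (*-cong-mod m≡1 Gz≡1) (mod-reflexive (⊗-identityˡ 𝟙))
      where
      m≡1 : κ m ≡ 𝟙 [mod κ 2 ]
      m≡1 = κ i , trans (κ-+ 1 (2 * i)) (cong (𝟙 ⊕_) (κ-* 2 i))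

    DrX≡Dr : D ⊗ (r ⊗ X) ≡ D ⊗ r [mod 𝟐^ (4 + n) ]
    DrX≡Dr = subst₂ (D ⊗ (r ⊗ X) ≡_[mod_]) (cong (D ⊗_) (⊗-identityʳ r))
      (trans (𝟐^-* (3 + n) 1) (cong 𝟐^_ (ℕ.+-comm (3 + n) 1)))
      (*-scale-mod D (*-cong-mod (mod-refl {r}) X≡1))

    z′^k≡t : (z ⊕ 𝟐^ (2 + n) ⊗ (r ⊗ G)) ^ k ≡ t [mod 𝟐^ (4 + n) ]
    z′^k≡t = begin
      (z ⊕ 𝟐^ (2 + n) ⊗ (r ⊗ G)) ^ k   ≲⟨ newton-expansion n z r G ⟩
      z ^ k ⊕ D ⊗ (r ⊗ X)              ≲⟨ +-cong-mod (mod-refl {z ^ k}) DrX≡Dr ⟩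
      z ^ k ⊕ D ⊗ r                    ≡⟨ t≡z^k+Dr ⟨
      t                                ∎
      where open ≡-mod-Reasoning (𝟐^ (4 + n))

  hensel : ∀ (w : ℕ → ℤ[π]) → Compatible w → ∀ v g → g ⊗ v ≡ 𝟙 [mod κ 2 ] → w 3 ≡ v ^ k [mod 𝟐^ 3 ] →
    Σ R λ y → ∀ n → w n ≡ embed (level y n) ^ k [mod 𝟐^ n ]
  hensel w w-compatible v g gv≡1 w₃≡v^k = limit root root-compatible , w≡y^k
    where
    Gz≡1 : ∀ {z} → z ≡ v [mod κ 2 ] → g ^ k₁ ⊗ z ^ k₁ ≡ 𝟙 [mod κ 2 ]
    Gz≡1 {z} z≡v = begin
      g ^ k₁ ⊗ z ^ k₁   ≡⟨ ^-distrib-* g z k₁ ⟨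
      (g ⊗ z) ^ k₁      ≲⟨ ^-mod-1# (mod-trans (*-cong-mod (mod-refl {g}) z≡v) gv≡1) k₁ ⟩
      𝟙                 ∎
      where open ≡-mod-Reasoning (κ 2)

    Approximation : ℕ → Set
    Approximation n = Σ ℤ[π] λ z → z ≡ v [mod κ 2 ] × w (3 + n) ≡ z ^ k [mod 𝟐^ (3 + n) ]

    refine : ∀ n (a : Approximation n) → Σ (Approximation (suc n)) λ a′ → proj₁ a′ ≡ proj₁ a [mod 𝟐^ (2 + n) ]
    refine n (z , z≡v , w≡z^k) =
      let (z′ , z′≡z , w≡z′^k) =
            hensel-step {z} {w (4 + n)} {g ^ k₁} n (Gz≡1 z≡v) (mod-trans (w-compatible (3 + n)) w≡z^k)
      in (z′ , mod-trans (mod-∣ (𝟐^-∣ {1} {2 + n} (s≤s z≤n)) z′≡z) z≡v , w≡z′^k) , z′≡z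

    approximation : ∀ n → Approximation n
    approximation zero    = v , mod-refl , w₃≡v^k
    approximation (suc n) = proj₁ (refine n (approximation n))

    root : ℕ → ℤ[π]
    root n = proj₁ (approximation n)

    root-compatible : Compatible root
    root-compatible n = mod-∣ (𝟐^-∣ (ℕ.m≤n+m n 2)) (proj₂ (refine n (approximation n)))

    w≡y^k : ∀ n → w n ≡ embed (level (limit root root-compatible) n) ^ k [mod 𝟐^ n ]
    w≡y^k n = begin
      w n         ≲⟨ mod-sym (compatible-mod w-compatible 3 n) ⟩
      w (3 + n)   ≲⟨ mod-∣ (𝟐^-∣ (ℕ.m≤n+m n 3)) (proj₂ (proj₂ (approximation n))) ⟩
      root n ^ k  ≲⟨ ^-cong-mod (mod-sym (level-limit root root-compatible n)) k ⟩
      embed (level (limit root root-compatible) n) ^ k ∎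
      where open ≡-mod-Reasoning (𝟐^ n)

-- Residues modulo 8

tri-cong : ∀ {a b c a′ b′ c′} → a ≡ a′ → b ≡ b′ → c ≡ c′ → tri a b c ≡ tri a′ b′ c′
tri-cong refl refl refl = refl

_≟ᵀ_ : DecidableEquality T
tri a b c ≟ᵀ tri a′ b′ c′ = map′ (λ (p , q , r) → tri-cong p q r) (λ { refl → refl , refl , refl })
  (a ℕ.≟ a′ ×-dec b ℕ.≟ b′ ×-dec c ℕ.≟ c′)

open DecMembership _≟ᵀ_ using (_∈?_)

mod8 : T → T
mod8 (tri a b c) = tri (a mod2^ 3) (b mod2^ 3) (c mod2^ 3)

mod8-cong : ∀ {s t} → s ≡T t [mod2^ 3 ] → mod8 s ≡ mod8 t
mod8-cong (a≡ , b≡ , c≡) = tri-cong a≡ b≡ c≡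

embed-mod8 : ∀ t → embed (mod8 t) ≡ embed t [mod 𝟐^ 3 ]
embed-mod8 (tri a b c) = ≡T⇒mod 3 (m%n%n≡m%n a 8 , m%n%n≡m%n b 8 , m%n%n≡m%n c 8)

mod8-cong-embed : ∀ {s t} → embed s ≡ embed t [mod 𝟐^ 3 ] → mod8 s ≡ mod8 t
mod8-cong-embed {s} {t} s≡t = mod8-cong {s} {t} (mod⇒≡T {s} {t} 3 s≡t)

residues8 : List T
residues8 = cartesianProductWith (λ a → uncurry (tri a)) (upTo 8) (cartesianProduct (upTo 8) (upTo 8))

mod8∈residues8 : ∀ t → mod8 t ∈ residues8
mod8∈residues8 (tri a b c) =
  ∈-cartesianProductWith⁺ (λ a → uncurry (tri a)) (digit a) (∈-cartesianProduct⁺ (digit b) (digit c))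
  where
  digit : ∀ n → n mod2^ 3 ∈ upTo 8
  digit n = ∈-upTo⁺ (m%n<n n 8)

unitSquareRoots : List T
unitSquareRoots =
  tri 1 0 0 ∷ tri 1 0 1 ∷ tri 1 1 0 ∷ tri 1 0 2 ∷ tri 1 1 1 ∷ tri 1 2 0 ∷ tri 1 0 3 ∷ tri 1 1 2 ∷
  tri 1 2 1 ∷ tri 1 3 0 ∷ tri 1 1 3 ∷ tri 1 2 2 ∷ tri 1 3 1 ∷ tri 3 1 1 ∷ tri 1 2 3 ∷ tri 1 3 2 ∷ []

unitSquares : List T
unitSquares = map (λ r → mod8 (powT r 2)) unitSquareRoots

kthPowerResidues : List T
kthPowerResidues = zeroT ∷ unitSquares

-- Entry (a, b, c) is the least number of elements of kthPowerResidues summing to a + bπ + cπ²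
-- modulo 8.  Such sums have even b, so the rows of odd b are left empty.
depthTable : List (List (List ℕ))
depthTable =
  ( (0 ∷ 4 ∷ 4 ∷ 4 ∷ 8 ∷ 4 ∷ 4 ∷ 4 ∷ []) ∷ [] ∷ (4 ∷ 4 ∷ 4 ∷ 4 ∷ 4 ∷ 4 ∷ 4 ∷ 4 ∷ []) ∷ [] ∷
    (8 ∷ 4 ∷ 4 ∷ 4 ∷ 8 ∷ 4 ∷ 4 ∷ 4 ∷ []) ∷ [] ∷ (4 ∷ 4 ∷ 4 ∷ 4 ∷ 4 ∷ 4 ∷ 4 ∷ 4 ∷ []) ∷ [] ∷ []) ∷
  ( (1 ∷ 5 ∷ 5 ∷ 5 ∷ 1 ∷ 5 ∷ 5 ∷ 5 ∷ []) ∷ [] ∷ (5 ∷ 1 ∷ 1 ∷ 5 ∷ 5 ∷ 1 ∷ 1 ∷ 5 ∷ []) ∷ [] ∷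
    (1 ∷ 5 ∷ 5 ∷ 5 ∷ 1 ∷ 5 ∷ 5 ∷ 5 ∷ []) ∷ [] ∷ (5 ∷ 1 ∷ 1 ∷ 5 ∷ 5 ∷ 1 ∷ 1 ∷ 5 ∷ []) ∷ [] ∷ []) ∷
  ( (2 ∷ 6 ∷ 2 ∷ 2 ∷ 2 ∷ 6 ∷ 2 ∷ 2 ∷ []) ∷ [] ∷ (6 ∷ 2 ∷ 2 ∷ 6 ∷ 6 ∷ 2 ∷ 2 ∷ 6 ∷ []) ∷ [] ∷
    (2 ∷ 6 ∷ 2 ∷ 2 ∷ 2 ∷ 6 ∷ 2 ∷ 2 ∷ []) ∷ [] ∷ (6 ∷ 2 ∷ 2 ∷ 6 ∷ 6 ∷ 2 ∷ 2 ∷ 6 ∷ []) ∷ [] ∷ []) ∷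
  ( (3 ∷ 7 ∷ 3 ∷ 3 ∷ 3 ∷ 7 ∷ 3 ∷ 3 ∷ []) ∷ [] ∷ (3 ∷ 3 ∷ 3 ∷ 3 ∷ 3 ∷ 3 ∷ 3 ∷ 3 ∷ []) ∷ [] ∷
    (3 ∷ 7 ∷ 3 ∷ 3 ∷ 3 ∷ 7 ∷ 3 ∷ 3 ∷ []) ∷ [] ∷ (3 ∷ 3 ∷ 3 ∷ 3 ∷ 3 ∷ 3 ∷ 3 ∷ 3 ∷ []) ∷ [] ∷ []) ∷
  ( (4 ∷ 4 ∷ 4 ∷ 4 ∷ 4 ∷ 4 ∷ 4 ∷ 4 ∷ []) ∷ [] ∷ (4 ∷ 4 ∷ 4 ∷ 4 ∷ 4 ∷ 4 ∷ 4 ∷ 4 ∷ []) ∷ [] ∷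
    (4 ∷ 4 ∷ 4 ∷ 4 ∷ 4 ∷ 4 ∷ 4 ∷ 4 ∷ []) ∷ [] ∷ (4 ∷ 4 ∷ 4 ∷ 4 ∷ 4 ∷ 4 ∷ 4 ∷ 4 ∷ []) ∷ [] ∷ []) ∷
  ( (5 ∷ 5 ∷ 5 ∷ 1 ∷ 5 ∷ 5 ∷ 5 ∷ 1 ∷ []) ∷ [] ∷ (5 ∷ 5 ∷ 5 ∷ 5 ∷ 5 ∷ 5 ∷ 5 ∷ 5 ∷ []) ∷ [] ∷
    (5 ∷ 5 ∷ 5 ∷ 1 ∷ 5 ∷ 5 ∷ 5 ∷ 1 ∷ []) ∷ [] ∷ (5 ∷ 5 ∷ 5 ∷ 5 ∷ 5 ∷ 5 ∷ 5 ∷ 5 ∷ []) ∷ [] ∷ []) ∷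
  ( (6 ∷ 6 ∷ 6 ∷ 2 ∷ 6 ∷ 6 ∷ 6 ∷ 2 ∷ []) ∷ [] ∷ (2 ∷ 2 ∷ 6 ∷ 6 ∷ 2 ∷ 2 ∷ 6 ∷ 6 ∷ []) ∷ [] ∷
    (6 ∷ 6 ∷ 6 ∷ 2 ∷ 6 ∷ 6 ∷ 6 ∷ 2 ∷ []) ∷ [] ∷ (2 ∷ 2 ∷ 6 ∷ 6 ∷ 2 ∷ 2 ∷ 6 ∷ 6 ∷ []) ∷ [] ∷ []) ∷
  ( (7 ∷ 3 ∷ 3 ∷ 3 ∷ 7 ∷ 3 ∷ 3 ∷ 3 ∷ []) ∷ [] ∷ (3 ∷ 3 ∷ 7 ∷ 7 ∷ 3 ∷ 3 ∷ 7 ∷ 7 ∷ []) ∷ [] ∷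
    (7 ∷ 3 ∷ 3 ∷ 3 ∷ 7 ∷ 3 ∷ 3 ∷ 3 ∷ []) ∷ [] ∷ (3 ∷ 3 ∷ 7 ∷ 7 ∷ 3 ∷ 3 ∷ 7 ∷ 7 ∷ []) ∷ [] ∷ []) ∷ []

lookupOr : ∀ {A : Set} → A → List A → ℕ → A
lookupOr default []       n       = default
lookupOr default (x ∷ xs) zero    = x
lookupOr default (x ∷ xs) (suc n) = lookupOr default xs n

depth : T → ℕ
depth (tri a b c) = lookupOr 0 (lookupOr [] (lookupOr [] depthTable a) b) c

minusSquare : T → T → T
minusSquare x r = mod8 (x +T (tri 7 0 0 *T powT r 2))

-- Representations of residues as sums of unit squares, found by walking down the depth table:
-- after the first square, each square removed lowers the depth by one.
descend : ℕ → T → List T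
descend zero    x = []
descend (suc d) x = maybe′ (λ r → r ∷ descend d (minusSquare x r)) []
  (find (λ r → depth (minusSquare x r) ℕ.≤? d) unitSquareRoots)

representation : T → List T
representation x = maybe′ (λ r → r ∷ descend (depth (minusSquare x r)) (minusSquare x r)) []
  (find (λ r → depth (minusSquare x r) ℕ.≤? 7) unitSquareRoots)

sumOfSquares : List T → T
sumOfSquares = foldr (λ r s → powT r 2 +T s) zeroT

IsRepresentation : T → List T → Set
IsRepresentation t L = 1 ≤ length L × length L ≤ 8 × mod8 (sumOfSquares L) ≡ t × All (_∈ unitSquareRoots) L

EvenMiddle : T → Set
EvenMiddle t = T.c₁ t % 2 ≡ 0

-- Decided by evaluation; opaque so that the evidence is never unfolded later.
opaque
  square-or-nilpotent : All (λ t → mod8 (powT t 9) ≡ zeroT ⊎ mod8 (powT t 2) ∈ unitSquares) residues8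
  square-or-nilpotent =
    from-yes (All.all? (λ t → mod8 (powT t 9) ≟ᵀ zeroT ⊎-dec mod8 (powT t 2) ∈? unitSquares) residues8)

  unitSquares-closed : All (λ p → All (λ q → mod8 (p *T q) ∈ unitSquares) unitSquares) unitSquares
  unitSquares-closed =
    from-yes (All.all? (λ p → All.all? (λ q → mod8 (p *T q) ∈? unitSquares) unitSquares) unitSquares)

  unitSquareRoots-order16 : All (λ r → mod8 (powT r 16) ≡ oneT) unitSquareRoots
  unitSquareRoots-order16 = from-yes (All.all? (λ r → mod8 (powT r 16) ≟ᵀ oneT) unitSquareRoots)

  depth-step : All (λ t → All (λ p → depth (mod8 (t +T p)) ≤ suc (depth t)) kthPowerResidues) residues8
  depth-step =
    from-yes (All.all? (λ t → All.all? (λ p → depth (mod8 (t +T p)) ℕ.≤? suc (depth t)) kthPowerResidues) residues8)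

  evenMiddle-step : All (λ t → All (λ p → EvenMiddle t → EvenMiddle (mod8 (t +T p))) kthPowerResidues) residues8
  evenMiddle-step = from-yes (All.all? (λ t → All.all? (λ p →
    (T.c₁ t % 2 ℕ.≟ 0) →-dec (T.c₁ (mod8 (t +T p)) % 2 ℕ.≟ 0)) kthPowerResidues) residues8)

  representation-valid : All (λ t → EvenMiddle t → IsRepresentation t (representation t)) residues8
  representation-valid =
    from-yes (All.all? (λ t → (T.c₁ t % 2 ℕ.≟ 0) →-dec isRepresentation? t (representation t)) residues8)
    where
    isRepresentation? : ∀ t L → Dec (IsRepresentation t L)
    isRepresentation? t L = 1 ℕ.≤? length L ×-dec length L ℕ.≤? 8 ×-dec mod8 (sumOfSquares L) ≟ᵀ t
      ×-dec All.all? (_∈? unitSquareRoots) L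

embed-powT-mod8 : ∀ t k → embed (powT t k) ≡ embed (powT (mod8 t) k) [mod 𝟐^ 3 ]
embed-powT-mod8 t k = begin
  embed (powT t k)           ≡⟨ embed-powT t k ⟩
  embed t ^ k                ≲⟨ ^-cong-mod (mod-sym (embed-mod8 t)) k ⟩
  embed (mod8 t) ^ k         ≡⟨ embed-powT (mod8 t) k ⟨
  embed (powT (mod8 t) k)    ∎
  where open ≡-mod-Reasoning (𝟐^ 3)

unitSquareRoot-order16 : ∀ {r} → r ∈ unitSquareRoots → embed r ^ 16 ≡ 𝟙 [mod 𝟐^ 3 ]
unitSquareRoot-order16 {r} r∈ = begin
  embed r ^ 16              ≡⟨ embed-powT r 16 ⟨
  embed (powT r 16)         ≲⟨ mod-sym (embed-mod8 (powT r 16)) ⟩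
  embed (mod8 (powT r 16))  ≡⟨ cong embed (All.lookup unitSquareRoots-order16 r∈) ⟩
  𝟙                         ∎
  where open ≡-mod-Reasoning (𝟐^ 3)

unitSquares-^-closed : ∀ {q} → q ∈ unitSquares → ∀ m →
  Σ T λ p → p ∈ unitSquares × embed q ^ m ≡ embed p [mod 𝟐^ 3 ]
unitSquares-^-closed q∈ zero    = oneT , here refl , mod-refl
unitSquares-^-closed {q} q∈ (suc m) =
  let (p , p∈ , q^m≡p) = unitSquares-^-closed q∈ m
  in mod8 (q *T p) , All.lookup (All.lookup unitSquares-closed q∈) p∈ , (begin
    embed q ⊗ embed q ^ m   ≲⟨ *-cong-mod (mod-refl {embed q}) q^m≡p ⟩
    embed q ⊗ embed p       ≡⟨ embed-* q p ⟨
    embed (q *T p)          ≲⟨ mod-sym (embed-mod8 (q *T p)) ⟩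
    embed (mod8 (q *T p))   ∎)
  where open ≡-mod-Reasoning (𝟐^ 3)

nilpotent-power : ∀ {t k} → 9 ≤ k → mod8 (powT t 9) ≡ zeroT → embed (powT t k) ≡ 𝟘 [mod 𝟐^ 3 ]
nilpotent-power {t} {k} 9≤k t⁹≡0 = begin
  embed (powT t k)              ≡⟨ embed-powT t k ⟩
  embed t ^ k                   ≡⟨ cong (embed t ^_) (sym 9+j≡k) ⟩
  embed t ^ (9 + j)             ≡⟨ ^-homo-* (embed t) 9 j ⟩
  embed t ^ 9 ⊗ embed t ^ j     ≡⟨ cong (_⊗ embed t ^ j) (embed-powT t 9) ⟨
  embed (powT t 9) ⊗ embed t ^ j ≲⟨ *-cong-mod (mod-sym (embed-mod8 (powT t 9))) (mod-refl {embed t ^ j}) ⟩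
  embed (mod8 (powT t 9)) ⊗ embed t ^ j ≡⟨ cong (λ u → embed u ⊗ embed t ^ j) t⁹≡0 ⟩
  𝟘 ⊗ embed t ^ j               ≡⟨ CommutativeRing.zeroˡ ℤ[π]-commutativeRing (embed t ^ j) ⟩
  𝟘                             ∎
  where
  open ≡-mod-Reasoning (𝟐^ 3)
  j = proj₁ (ℕ.m≤n⇒∃[o]m+o≡n 9≤k)
  9+j≡k = proj₂ (ℕ.m≤n⇒∃[o]m+o≡n 9≤k)

unitSquare-power : ∀ {t} → mod8 (powT t 2) ∈ unitSquares → ∀ m →
  Σ T λ p → p ∈ unitSquares × embed (powT t (2 * m)) ≡ embed p [mod 𝟐^ 3 ]
unitSquare-power {t} t²∈ m =
  let (p , p∈ , q^m≡p) = unitSquares-^-closed t²∈ m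
  in p , p∈ , (begin
    embed (powT t (2 * m))        ≡⟨ embed-powT t (2 * m) ⟩
    embed t ^ (2 * m)             ≡⟨ ^-assocʳ (embed t) 2 m ⟨
    (embed t ^ 2) ^ m             ≡⟨ cong (_^ m) (embed-powT t 2) ⟨
    embed (powT t 2) ^ m          ≲⟨ ^-cong-mod (mod-sym (embed-mod8 (powT t 2))) m ⟩
    embed (mod8 (powT t 2)) ^ m   ≲⟨ q^m≡p ⟩
    embed p                       ∎)
  where open ≡-mod-Reasoning (𝟐^ 3)

kthPower-mod8 : ∀ {k} m → k ≡ 2 * m → 9 ≤ k → ∀ t →
  Σ T λ p → p ∈ kthPowerResidues × embed (powT t k) ≡ embed p [mod 𝟐^ 3 ]
kthPower-mod8 m refl 9≤k t = [ nilpotent , unit ]′ (All.lookup square-or-nilpotent (mod8∈residues8 t))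
  where
  Residue = Σ T λ p → p ∈ kthPowerResidues × embed (powT t (2 * m)) ≡ embed p [mod 𝟐^ 3 ]

  nilpotent : mod8 (powT (mod8 t) 9) ≡ zeroT → Residue
  nilpotent s⁹≡0 = zeroT , here refl , mod-trans (embed-powT-mod8 t (2 * m)) (nilpotent-power 9≤k s⁹≡0)

  unit : mod8 (powT (mod8 t) 2) ∈ unitSquares → Residue
  unit s²∈ = let (p , p∈ , s^k≡p) = unitSquare-power s²∈ m in p , there p∈ , mod-trans (embed-powT-mod8 t (2 * m)) s^k≡p

kthPowerSum-invariant : ∀ {k} m → k ≡ 2 * m → 9 ≤ k → (Φ : T → ℕ → Set) → Φ zeroT 0 →
  (∀ {t p n} → t ∈ residues8 → p ∈ kthPowerResidues → Φ t n → Φ (mod8 (t +T p)) (suc n)) →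
  ∀ ys → Φ (mod8 (sumPowLevel k ys 3)) (length ys)
kthPowerSum-invariant m k≡2m 9≤k Φ Φ₀ Φ-step []       = Φ₀
kthPowerSum-invariant {k} m k≡2m 9≤k Φ Φ₀ Φ-step (y ∷ ys) =
  subst (λ t → Φ t (suc (length ys))) (mod8-cong-embed sum≡)
    (Φ-step (mod8∈residues8 rest) p∈ (kthPowerSum-invariant m k≡2m 9≤k Φ Φ₀ Φ-step ys))
  where
  rest = sumPowLevel k ys 3
  p = proj₁ (kthPower-mod8 m k≡2m 9≤k (level y 3))
  p∈ = proj₁ (proj₂ (kthPower-mod8 m k≡2m 9≤k (level y 3)))
  y^k≡p = proj₂ (proj₂ (kthPower-mod8 m k≡2m 9≤k (level y 3)))

  sum≡ : embed (mod8 rest +T p) ≡ embed (powT (level y 3) k +T rest) [mod 𝟐^ 3 ]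
  sum≡ = begin
    embed (mod8 rest +T p)                    ≡⟨ embed-+ (mod8 rest) p ⟩
    embed (mod8 rest) ⊕ embed p               ≡⟨ ⊕-comm (embed (mod8 rest)) (embed p) ⟩
    embed p ⊕ embed (mod8 rest)               ≲⟨ +-cong-mod (mod-sym y^k≡p) (embed-mod8 rest) ⟩
    embed (powT (level y 3) k) ⊕ embed rest   ≡⟨ embed-+ (powT (level y 3) k) rest ⟨
    embed (powT (level y 3) k +T rest)        ∎
    where open ≡-mod-Reasoning (𝟐^ 3)

odd-square : ∀ i → Σ ℕ λ s → (1 + 2 * i) * (1 + 2 * i) ≡ 1 + 8 * s
odd-square zero          = 0 , refl
odd-square (suc zero)    = 1 , refl
odd-square (suc (suc i)) =
  let (s , sq≡) = odd-square i
  in s + (3 + 2 * i) , trans (expand i) (trans (cong (_+ 8 * (3 + 2 * i)) sq≡) (regroup s i))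
  where
  expand : ∀ i → (1 + 2 * (2 + i)) * (1 + 2 * (2 + i)) ≡ (1 + 2 * i) * (1 + 2 * i) + 8 * (3 + 2 * i)
  expand = ℕ-Solver.solve-∀
  regroup : ∀ s i → 1 + 8 * s + 8 * (3 + 2 * i) ≡ 1 + 8 * (s + (3 + 2 * i))
  regroup = ℕ-Solver.solve-∀

module WaringNumber (i : ℕ) (9≤k : 9 ≤ 2 + 4 * i) where

  private
    k m : ℕ
    k = 2 + 4 * i
    m = 1 + 2 * i

  m*k≡2+16s : Σ ℕ λ s → m * k ≡ 2 + 16 * s
  m*k≡2+16s =
    let (s , m²≡) = odd-square i in s , trans (double i) (trans (cong (2 *_) m²≡) (regroup s))
    where
    double : ∀ i → (1 + 2 * i) * (2 + 4 * i) ≡ 2 * ((1 + 2 * i) * (1 + 2 * i))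
    double = ℕ-Solver.solve-∀
    regroup : ∀ s → 2 * (1 + 8 * s) ≡ 2 + 16 * s
    regroup = ℕ-Solver.solve-∀

  lift : T → ℤ[π]
  lift r = embed r ^ m

  lift-^k : ∀ {r} → r ∈ unitSquareRoots → lift r ^ k ≡ embed r ^ 2 [mod 𝟐^ 3 ]
  lift-^k {r} r∈ = begin
    (embed r ^ m) ^ k                   ≡⟨ ^-assocʳ (embed r) m k ⟩
    embed r ^ (m * k)                   ≡⟨ cong (embed r ^_) (proj₂ m*k≡2+16s) ⟩
    embed r ^ (2 + 16 * s)              ≡⟨ ^-homo-* (embed r) 2 (16 * s) ⟩
    embed r ^ 2 ⊗ embed r ^ (16 * s)    ≡⟨ cong (embed r ^ 2 ⊗_) (^-assocʳ (embed r) 16 s) ⟨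
    embed r ^ 2 ⊗ (embed r ^ 16) ^ s    ≲⟨ *-cong-mod (mod-refl {embed r ^ 2}) (^-mod-1# r¹⁶≡1 s) ⟩
    embed r ^ 2 ⊗ 𝟙                     ≡⟨ ⊗-identityʳ (embed r ^ 2) ⟩
    embed r ^ 2                         ∎
    where
    open ≡-mod-Reasoning (𝟐^ 3)
    s = proj₁ m*k≡2+16s
    r¹⁶≡1 = unitSquareRoot-order16 r∈

  lift-invertible : ∀ {r} → r ∈ unitSquareRoots → (embed r ^ 15) ^ m ⊗ lift r ≡ 𝟙 [mod κ 2 ]
  lift-invertible {r} r∈ = mod-∣ (𝟐^-∣ {1} {3} (s≤s z≤n)) (begin
    (embed r ^ 15) ^ m ⊗ embed r ^ m    ≡⟨ ^-distrib-* (embed r ^ 15) (embed r) m ⟨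
    (embed r ^ 15 ⊗ embed r) ^ m        ≡⟨ cong (_^ m) (⊗-comm (embed r ^ 15) (embed r)) ⟩
    (embed r ^ 16) ^ m                  ≲⟨ ^-mod-1# (unitSquareRoot-order16 r∈) m ⟩
    𝟙                                   ∎)
    where open ≡-mod-Reasoning (𝟐^ 3)

  powerSum-lift : ∀ L → All (_∈ unitSquareRoots) L →
    powerSum k (map lift L) ≡ embed (sumOfSquares L) [mod 𝟐^ 3 ]
  powerSum-lift []       []         = mod-refl
  powerSum-lift (r ∷ L) (r∈ ∷ L∈) = begin
    lift r ^ k ⊕ powerSum k (map lift L)          ≲⟨ +-cong-mod (lift-^k r∈) (powerSum-lift L L∈) ⟩
    embed r ^ 2 ⊕ embed (sumOfSquares L)          ≡⟨ cong (_⊕ embed (sumOfSquares L)) (embed-powT r 2) ⟨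
    embed (powT r 2) ⊕ embed (sumOfSquares L)     ≡⟨ embed-+ (powT r 2) (sumOfSquares L) ⟨
    embed (sumOfSquares (r ∷ L))                  ∎
    where open ≡-mod-Reasoning (𝟐^ 3)

  depth-bound : ∀ ys → depth (mod8 (sumPowLevel k ys 3)) ≤ length ys
  depth-bound = kthPowerSum-invariant m (k≡2m i) 9≤k (λ t n → depth t ≤ n) z≤n
    (λ t∈ p∈ d≤n → ℕ.≤-trans (All.lookup (All.lookup depth-step t∈) p∈) (s≤s d≤n))

  evenMiddle-sum : ∀ ys → EvenMiddle (mod8 (sumPowLevel k ys 3))
  evenMiddle-sum = kthPowerSum-invariant m (k≡2m i) 9≤k (λ t _ → EvenMiddle t) refl
    (λ t∈ p∈ → All.lookup (All.lookup evenMiddle-step t∈) p∈)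

  representation⇒sumOfPowers : ∀ x L → IsRepresentation (mod8 (level x 3)) L →
    ∃ λ ys → length ys ≤ 8 × IsSumOfPowers k x ys
  representation⇒sumOfPowers x []       (() , _)
  representation⇒sumOfPowers x (v ∷ rs) (_ , length≤8 , Σ≡x , v∈ ∷ rs∈) =
    y ∷ map (const ∘ lift) rs , length-ys , mod⇒isSumOfPowers k x (y ∷ map (const ∘ lift) rs) x≡Σ
    where
    S = powerSum k (map lift rs)

    x₃≡ : embed (level x 3) ≡ lift v ^ k ⊕ S [mod 𝟐^ 3 ]
    x₃≡ = begin
      embed (level x 3)                      ≲⟨ mod-sym (embed-mod8 (level x 3)) ⟩
      embed (mod8 (level x 3))               ≡⟨ cong embed Σ≡x ⟨
      embed (mod8 (sumOfSquares (v ∷ rs)))   ≲⟨ embed-mod8 (sumOfSquares (v ∷ rs)) ⟩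
      embed (sumOfSquares (v ∷ rs))          ≲⟨ mod-sym (powerSum-lift (v ∷ rs) (v∈ ∷ rs∈)) ⟩
      lift v ^ k ⊕ S                         ∎
      where open ≡-mod-Reasoning (𝟐^ 3)

    w : ℕ → ℤ[π]
    w n = embed (level x n) ⊕ ⊖ S

    w₃≡ : w 3 ≡ lift v ^ k [mod 𝟐^ 3 ]
    w₃≡ = mod-trans (+-cong-mod x₃≡ (mod-refl {⊖ S})) (mod-reflexive (cancel (lift v ^ k) S))
      where
      cancel : ∀ a s → a ⊕ s ⊕ ⊖ s ≡ a
      cancel = Solver.solve-∀ ℤ[π]-ring

    root : Σ R λ y → ∀ n → w n ≡ embed (level y n) ^ k [mod 𝟐^ n ]
    root = hensel i w (λ n → +-cong-mod (level-compatible x n) (mod-refl {⊖ S}))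
      (lift v) ((embed v ^ 15) ^ m) (lift-invertible v∈) w₃≡

    y : R
    y = proj₁ root

    length-ys : length (y ∷ map (const ∘ lift) rs) ≤ 8
    length-ys = subst (_≤ 8) (cong suc (sym (List.length-map (const ∘ lift) rs))) length≤8

    x≡Σ : ∀ n → embed (level x n) ≡ powerSum k (levels (y ∷ map (const ∘ lift) rs) n) [mod 𝟐^ n ]
    x≡Σ n = begin
      embed (level x n)   ≡⟨ uncancel (embed (level x n)) S ⟩
      w n ⊕ S             ≲⟨ +-cong-mod (proj₂ root n) (powerSum-levels-const k lift rs n) ⟩
      embed (level y n) ^ k ⊕ powerSum k (levels (map (const ∘ lift) rs) n) ∎
      where
      open ≡-mod-Reasoning (𝟐^ n)
      uncancel : ∀ a s → a ≡ a ⊕ ⊖ s ⊕ s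
      uncancel = Solver.solve-∀ ℤ[π]-ring

  waringBound : WaringBound k 8
  waringBound x (ys , x≡Σys) = representation⇒sumOfPowers x (representation (mod8 (level x 3)))
    (All.lookup representation-valid (mod8∈residues8 (level x 3)) even)
    where
    even : EvenMiddle (mod8 (level x 3))
    even = subst EvenMiddle (sym (mod8-cong {level x 3} {sumPowLevel k ys 3} (x≡Σys 3))) (evenMiddle-sum ys)

  target : List T
  target = representation (tri 0 0 4)

  target-valid : IsRepresentation (tri 0 0 4) target
  target-valid = All.lookup representation-valid (mod8∈residues8 (tri 0 0 4)) refl

  x₀ : R
  x₀ = const (powerSum k (map lift target))

  x₀-sum : IsSumOfPowers k x₀ (map (const ∘ lift) target)
  x₀-sum = mod⇒isSumOfPowers k x₀ (map (const ∘ lift) target)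
    (λ n → mod-trans (level-const (powerSum k (map lift target)) n) (powerSum-levels-const k lift target n))

  x₀-residue : mod8 (level x₀ 3) ≡ tri 0 0 4
  x₀-residue = mod8-cong-embed {level x₀ 3} {tri 0 0 4} (begin
    embed (level x₀ 3)                    ≲⟨ level-const (powerSum k (map lift target)) 3 ⟩
    powerSum k (map lift target)          ≲⟨ powerSum-lift target (proj₂ (proj₂ (proj₂ target-valid))) ⟩
    embed (sumOfSquares target)           ≲⟨ mod-sym (embed-mod8 (sumOfSquares target)) ⟩
    embed (mod8 (sumOfSquares target))    ≡⟨ cong embed (proj₁ (proj₂ (proj₂ target-valid))) ⟩
    embed (tri 0 0 4)                     ∎)
    where open ≡-mod-Reasoning (𝟐^ 3)

  ¬waringBound : ∀ n → n < 8 → ¬ WaringBound k n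
  ¬waringBound n n<8 bound = ℕ.<-irrefl refl (ℕ.≤-<-trans (ℕ.≤-trans 8≤length length≤n) n<8)
    where
    ys = proj₁ (bound x₀ (map (const ∘ lift) target , x₀-sum))
    length≤n = proj₁ (proj₂ (bound x₀ (map (const ∘ lift) target , x₀-sum)))
    x₀≡Σys = proj₂ (proj₂ (bound x₀ (map (const ∘ lift) target , x₀-sum)))

    8≤length : 8 ≤ length ys
    8≤length = subst (_≤ length ys)
      (cong depth (trans (sym (mod8-cong {level x₀ 3} {sumPowLevel k ys 3} (x₀≡Σys 3))) x₀-residue))
      (depth-bound ys)

theorem3p8 : (k : ℕ) → k % 4 ≡ 2 → 10 ≤ k → IsWaringNumber k 8
theorem3p8 k k%4≡2 10≤k = subst (λ k → IsWaringNumber k 8) (sym k≡2+4i)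
  (s≤s z≤n , waringBound , λ n _ n<8 → ¬waringBound n n<8)
  where
  i = k / 4
  k≡2+4i : k ≡ 2 + 4 * i
  k≡2+4i = trans (m≡m%n+[m/n]*n k 4) (cong₂ _+_ k%4≡2 (ℕ.*-comm i 4))
  open WaringNumber i (subst (9 ≤_) k≡2+4i (ℕ.<⇒≤ 10≤k))
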